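{- Let $a\ge -1$ be an integer and $\rho$ the largest root of $x^3-ax^2-(a+3)x-1$. If $2=\alpha_1+\alpha_2$ with $\alpha_1,\alpha_2\in\mathbb{Z}[\rho]^+\cup\{0\}$, then $\{\alpha_1,\alpha_2\}=\{0,2\}$ or $\alpha_1=\alpha_2=1$. If $3=\alpha_1+\alpha_2$ with $\alpha_1,\alpha_2\in\mathbb{Z}[\rho]^+\cup\{0\}$, then $\{\alpha_1,\alpha_2\}=\{0,3\}$ or $\{\alpha_1,\alpha_2\}=\{1,2\}$.
   Context: $\mathbb{Q}(\rho)$ is a totally real cubic field; $\mathbb{Z}[\rho]^+$ denotes the set of elements of $\mathbb{Z}[\rho]$ all of whose real conjugates are positive (totally positive). -}

module Defs where

open import Level using (Level; _⊔_; suc)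
open import Algebra.Bundles using (CommutativeRing)
open import Relation.Binary.Core using (Rel)
open import Relation.Binary.Structures using (IsStrictTotalOrder)
open import Data.Nat using (ℕ)
import Data.Nat as ℕ
open import Data.Integer using (ℤ; +_; -[1+_])
open import Data.Product using (_×_; _,_)
open import Data.Sum using (_⊎_)
open import Relation.Binary.PropositionalEquality using (_≡_)

record OrderedCommRing (c ℓ₁ ℓ₂ : Level) : Set (suc (c ⊔ ℓ₁ ⊔ ℓ₂)) where
  field
    commutativeRing : CommutativeRing c ℓ₁
  open CommutativeRing commutativeRing public
  field
    _<_                : Rel Carrier ℓ₂
    isStrictTotalOrder : IsStrictTotalOrder _≈_ _<_
    0<1                : 0# < 1#
    +-mono-<           : ∀ {x y} z → x < y → (x + z) < (y + z)
    *-pos              : ∀ {x y} → 0# < x → 0# < y → 0# < (x * y)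

  ιℕ : ℕ → Carrier
  ιℕ ℕ.zero    = 0#
  ιℕ (ℕ.suc n) = 1# + ιℕ n

  ι : ℤ → Carrier
  ι (+ n)      = ιℕ n
  ι -[1+ n ]   = - ιℕ (ℕ.suc n)

-- An element of ℤ[ρ], written x + y ρ + z ρ² (coordinates w.r.t. the
-- ℤ-basis 1, ρ, ρ² of ℤ[ρ], the minimal polynomial being cubic).
Zρ : Set
Zρ = ℤ × ℤ × ℤ

module _ {c ℓ₁ ℓ₂} (R : OrderedCommRing c ℓ₁ ℓ₂) where
  open OrderedCommRing R

  cubic : ℤ → Carrier → Carrier
  cubic a x = x * x * x - ι a * (x * x) - ι (a Data.Integer.+ + 3) * x - 1#

  eval : Zρ → Carrier → Carrier
  eval (x , y , z) r = ι x + ι y * r + ι z * (r * r)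

  TotPos : Carrier → Carrier → Carrier → Zρ → Set ℓ₂
  TotPos ρ₁ ρ₂ ρ₃ α = (0# < eval α ρ₁) × (0# < eval α ρ₂) × (0# < eval α ρ₃)

  TotPos₀ : Carrier → Carrier → Carrier → Zρ → Set ℓ₂
  TotPos₀ ρ₁ ρ₂ ρ₃ α = (α ≡ (+ 0 , + 0 , + 0)) ⊎ TotPos ρ₁ ρ₂ ρ₃ α

int : ℤ → Zρ
int n = (n , + 0 , + 0)

_⊕_ : Zρ → Zρ → Zρ
(x , y , z) ⊕ (x' , y' , z') = (x Data.Integer.+ x' , y Data.Integer.+ y' , z Data.Integer.+ z')

module Submission where

-- If α = x + yρ + zρ² is totally positive and α + β = n ≤ 3 with β ∈ ℤ[ρ]⁺ ∪ {0}, the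
-- conjugates of α lie in (0, 3], and then the Vandermonde product V(α) = ∏ᵢ<ⱼ (αᵢ − αⱼ)
-- satisfies 16 V(α)² < 729 (for sorted conjugates p ≤ q ≤ r, |V| ≤ (r − p)³/4).
-- On the other hand V(α) = V(ρ) F, where V(ρ)² = disc f_a = (a² + 3a + 9)² ≥ 49 for a ≥ −1
-- and F = ∏ (y + z(ρᵢ + ρⱼ)) = N(u − zρ), u = y + az, is a value of the integral norm form.
-- Hence F = 0; the norm form has no non-trivial zero (2-adic descent), so y = z = 0 and α
-- is a positive rational integer. What remains is splitting 2 and 3 into non-negative integers.

open import Defs
open import Data.Nat as ℕ using (ℕ; zero; suc; s≤s; z≤n)
import Data.Nat.Properties as ℕₚ
open import Data.Integer as ℤ using (ℤ; +_; -[1+_]; _≤_; ∣_∣; _⊖_)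
import Data.Integer.Properties as ℤₚ
open import Data.Integer.DivMod using (_%ℕ_; _/ℕ_; n%ℕd<d; a≡a%ℕn+[a/ℕn]*n)
open import Data.Integer.Solver using (module +-*-Solver)
open import Data.Sign using (Sign)
open import Data.Product as Prod using (_×_; _,_; Σ; proj₁; proj₂)
open import Data.Sum using (_⊎_; inj₁; inj₂)
open import Data.Empty using (⊥-elim)
open import Data.Maybe using (Maybe; just; nothing)
open import Data.Vec as Vec using (Vec; []; _∷_)
import Data.Vec.Properties as Vecₚ
open import Data.Vec.Relation.Binary.Pointwise.Inductive as Pointwise using (Pointwise; []; _∷_)
open import Data.Fin using (#_)
open import Function using (_∘_; id)
open import Level using (_⊔_)
open import Relation.Binary.PropositionalEquality as ≡ using (_≡_; _≢_)
open import Relation.Binary.Definitions using (tri<; tri≈; tri>)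
open import Relation.Binary.Structures using (IsStrictTotalOrder)
open import Relation.Nullary using (yes; no)
open import Algebra.Solver.Ring.AlmostCommutativeRing using (fromCommutativeRing; _-Raw-AlmostCommutative⟶_)

module _ where
  open import Data.Integer using (_+_; _*_; _-_; -_)
  open ≡ using (refl; sym; trans; cong; cong₂; subst)

  ⊕-comm : ∀ α β → α ⊕ β ≡ β ⊕ α
  ⊕-comm (x , y , z) (x′ , y′ , z′) = cong₂ _,_ (ℤₚ.+-comm x x′) (cong₂ _,_ (ℤₚ.+-comm y y′) (ℤₚ.+-comm z z′))

  IntegerParts : Zρ → Zρ → ℕ → Set
  IntegerParts α₁ α₂ n = Σ ℕ λ m₁ → Σ ℕ λ m₂ → α₁ ≡ int (+ m₁) × α₂ ≡ int (+ m₂) × m₁ ℕ.+ m₂ ≡ n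

  integerParts₂ : ∀ {α₁ α₂} → IntegerParts α₁ α₂ 2 →
    ((α₁ ≡ int (+ 0) × α₂ ≡ int (+ 2)) ⊎ (α₁ ≡ int (+ 2) × α₂ ≡ int (+ 0))) ⊎ (α₁ ≡ int (+ 1) × α₂ ≡ int (+ 1))
  integerParts₂ (0 , _ , α₁≡ , α₂≡ , refl) = inj₁ (inj₁ (α₁≡ , α₂≡))
  integerParts₂ (1 , _ , α₁≡ , α₂≡ , refl) = inj₂ (α₁≡ , α₂≡)
  integerParts₂ (2 , _ , α₁≡ , α₂≡ , refl) = inj₁ (inj₂ (α₁≡ , α₂≡))

  integerParts₃ : ∀ {α₁ α₂} → IntegerParts α₁ α₂ 3 →
    ((α₁ ≡ int (+ 0) × α₂ ≡ int (+ 3)) ⊎ (α₁ ≡ int (+ 3) × α₂ ≡ int (+ 0)))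
    ⊎ ((α₁ ≡ int (+ 1) × α₂ ≡ int (+ 2)) ⊎ (α₁ ≡ int (+ 2) × α₂ ≡ int (+ 1)))
  integerParts₃ (0 , _ , α₁≡ , α₂≡ , refl) = inj₁ (inj₁ (α₁≡ , α₂≡))
  integerParts₃ (1 , _ , α₁≡ , α₂≡ , refl) = inj₂ (inj₁ (α₁≡ , α₂≡))
  integerParts₃ (2 , _ , α₁≡ , α₂≡ , refl) = inj₂ (inj₂ (α₁≡ , α₂≡))
  integerParts₃ (3 , _ , α₁≡ , α₂≡ , refl) = inj₁ (inj₂ (α₁≡ , α₂≡))

  -- cubicForm a u v = ∏ᵢ (u − v ρᵢ), the norm of u − vρ.
  cubicForm : ℤ → ℤ → ℤ → ℤ
  cubicForm a u v = u * u * u - a * (u * u) * v - (a + + 3) * u * (v * v) - v * v * v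

  data Parity : ℤ → Set where
    even : ∀ q → Parity (q * + 2)
    odd  : ∀ q → Parity (+ 1 + q * + 2)

  parity : ∀ i → Parity i
  parity i with i %ℕ 2 | n%ℕd<d i 2 | a≡a%ℕn+[a/ℕn]*n i 2
  ... | 0 | _ | eq rewrite eq | ℤₚ.+-identityˡ ((i /ℕ 2) * + 2) = even (i /ℕ 2)
  ... | 1 | _ | eq rewrite eq = odd (i /ℕ 2)
  ... | suc (suc _) | s≤s (s≤s ()) | _

  odd≢0 : ∀ k → + 1 + k * + 2 ≢ + 0
  odd≢0 (+ zero) ()
  odd≢0 (+ suc n) ()
  odd≢0 -[1+ n ] ()

  oddPart : ℤ → ℤ → ℤ → ℤ
  oddPart a q s = q * (+ 3 + q * (+ 6 + q * + 4)) - s * (a * (u * u) + (a + + 3) * u * v + v * v)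
    where
    u v : ℤ
    u = + 1 + q * + 2
    v = s * + 2

  module _ where
    open +-*-Solver

    private
      cubicFormᵖ : ∀ {n} → Polynomial n → Polynomial n → Polynomial n → Polynomial n
      cubicFormᵖ a u v = u :* u :* u :- a :* (u :* u) :* v :- (a :+ con (+ 3)) :* u :* (v :* v) :- v :* v :* v

    cubicForm-homogeneous : ∀ a q s → cubicForm a (q * + 2) (s * + 2) ≡ + 8 * cubicForm a q s
    cubicForm-homogeneous = solve 3 (λ a q s →
      cubicFormᵖ a (q :* con (+ 2)) (s :* con (+ 2)) := con (+ 8) :* cubicFormᵖ a q s) refl

    cubicForm-oddEven : ∀ a q s → cubicForm a (+ 1 + q * + 2) (s * + 2) ≡ + 1 + oddPart a q s * + 2
    cubicForm-oddEven = solve 3 (λ a q s →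
      let u = con (+ 1) :+ q :* con (+ 2); v = s :* con (+ 2) in
      cubicFormᵖ a u v
        := con (+ 1) :+ (q :* (con (+ 3) :+ q :* (con (+ 6) :+ q :* con (+ 4)))
                         :- s :* (a :* (u :* u) :+ (a :+ con (+ 3)) :* u :* v :+ v :* v)) :* con (+ 2)) refl

    -- (u, v) ↦ (v, −u − v) preserves the form (it comes from the automorphism ρ ↦ −1/(1 + ρ));
    -- it and its square carry the parity classes (odd, odd) and (even, odd) to (odd, even).
    cubicForm-evenOdd : ∀ a q s →
      cubicForm a (q * + 2) (+ 1 + s * + 2) ≡ cubicForm a (+ 1 + (- (q + s) - + 1) * + 2) (q * + 2)
    cubicForm-evenOdd = solve 3 (λ a q s →
      cubicFormᵖ a (q :* con (+ 2)) (con (+ 1) :+ s :* con (+ 2))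
        := cubicFormᵖ a (con (+ 1) :+ (:- (q :+ s) :- con (+ 1)) :* con (+ 2)) (q :* con (+ 2))) refl

    cubicForm-oddOdd : ∀ a q s →
      cubicForm a (+ 1 + q * + 2) (+ 1 + s * + 2) ≡ cubicForm a (+ 1 + s * + 2) ((- (q + s) - + 1) * + 2)
    cubicForm-oddOdd = solve 3 (λ a q s →
      cubicFormᵖ a (con (+ 1) :+ q :* con (+ 2)) (con (+ 1) :+ s :* con (+ 2))
        := cubicFormᵖ a (con (+ 1) :+ s :* con (+ 2)) ((:- (q :+ s) :- con (+ 1)) :* con (+ 2))) refl

  m*2≤1+n⇒m≤n : ∀ m n → m ℕ.* 2 ℕ.≤ suc n → m ℕ.≤ n
  m*2≤1+n⇒m≤n zero n _ = z≤n
  m*2≤1+n⇒m≤n (suc m) n (s≤s le) = ℕₚ.≤-trans (s≤s (ℕₚ.m≤m*n m 2)) le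

  size : ℤ → ℤ → ℕ
  size u v = ∣ u ∣ ℕ.+ ∣ v ∣

  size-halves : ∀ q s n → size (q * + 2) (s * + 2) ℕ.≤ suc n → size q s ℕ.≤ n
  size-halves q s n le = m*2≤1+n⇒m≤n (size q s) n (subst (ℕ._≤ suc n) doubled le)
    where
    doubled : size (q * + 2) (s * + 2) ≡ size q s ℕ.* 2
    doubled = trans (cong₂ ℕ._+_ (ℤₚ.abs-* q (+ 2)) (ℤₚ.abs-* s (+ 2))) (sym (ℕₚ.*-distribʳ-+ 2 ∣ q ∣ ∣ s ∣))

  cubicForm≡0⇒trivial : ∀ a u v → cubicForm a u v ≡ + 0 → u ≡ + 0 × v ≡ + 0
  cubicForm≡0⇒trivial a u v = descend (size u v) u v ℕₚ.≤-refl
    where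
    oddEven≢0 : ∀ q s → cubicForm a (+ 1 + q * + 2) (s * + 2) ≢ + 0
    oddEven≢0 q s eq = odd≢0 (oddPart a q s) (trans (sym (cubicForm-oddEven a q s)) eq)

    descend : ∀ n u v → size u v ℕ.≤ n → cubicForm a u v ≡ + 0 → u ≡ + 0 × v ≡ + 0
    descend zero u v small _ = ℤₚ.∣i∣≡0⇒i≡0 (ℕₚ.m+n≡0⇒m≡0 ∣ u ∣ sum≡0) , ℤₚ.∣i∣≡0⇒i≡0 (ℕₚ.m+n≡0⇒n≡0 ∣ u ∣ sum≡0)
      where
      sum≡0 : size u v ≡ 0
      sum≡0 = ℕₚ.n≤0⇒n≡0 small
    descend (suc n) u v small eq with parity u | parity v
    ... | odd q  | even s = ⊥-elim (oddEven≢0 q s eq)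
    ... | even q | odd s  = ⊥-elim (oddEven≢0 (- (q + s) - + 1) q (trans (sym (cubicForm-evenOdd a q s)) eq))
    ... | odd q  | odd s  = ⊥-elim (oddEven≢0 s (- (q + s) - + 1) (trans (sym (cubicForm-oddOdd a q s)) eq))
    ... | even q | even s = Prod.map (cong (_* + 2)) (cong (_* + 2)) (descend n q s (size-halves q s n small) halved)
      where
      halved : cubicForm a q s ≡ + 0
      halved = ℤₚ.*-cancelˡ-≡ (+ 8) (cubicForm a q s) (+ 0) (trans (sym (cubicForm-homogeneous a q s)) eq)

module _ {c ℓ₁ ℓ₂} (R : OrderedCommRing c ℓ₁ ℓ₂) where
  open OrderedCommRing R
  private module < = IsStrictTotalOrder isStrictTotalOrder
  open import Algebra.Properties.Ring ring using (-0#≈0#; -‿involutive; -‿+-comm; -‿distribˡ-*; -‿distribʳ-*)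
  open import Relation.Binary.Reasoning.Setoid setoid

  ιℕ-+ : ∀ m n → ιℕ (m ℕ.+ n) ≈ ιℕ m + ιℕ n
  ιℕ-+ zero    n = sym (+-identityˡ _)
  ιℕ-+ (suc m) n = trans (+-cong refl (ιℕ-+ m n)) (sym (+-assoc _ _ _))

  ιℕ-* : ∀ m n → ιℕ (m ℕ.* n) ≈ ιℕ m * ιℕ n
  ιℕ-* zero    n = sym (zeroˡ _)
  ιℕ-* (suc m) n = begin
    ιℕ (n ℕ.+ m ℕ.* n)       ≈⟨ ιℕ-+ n (m ℕ.* n) ⟩
    ιℕ n + ιℕ (m ℕ.* n)      ≈⟨ +-cong (sym (*-identityˡ _)) (ιℕ-* m n) ⟩
    1# * ιℕ n + ιℕ m * ιℕ n  ≈⟨ sym (distribʳ _ _ _) ⟩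
    (1# + ιℕ m) * ιℕ n       ∎

  ι-neg : ∀ i → ι (ℤ.- i) ≈ - ι i
  ι-neg (+ zero)  = sym -0#≈0#
  ι-neg (+ suc n) = refl
  ι-neg -[1+ n ]  = sym (-‿involutive _)

  ι-⊖ : ∀ m n → ι (m ⊖ n) ≈ ιℕ m - ιℕ n
  ι-⊖ zero    zero    = sym (-‿inverseʳ _)
  ι-⊖ zero    (suc n) = sym (+-identityˡ _)
  ι-⊖ (suc m) zero    = sym (trans (+-cong refl -0#≈0#) (+-identityʳ _))
  ι-⊖ (suc m) (suc n) rewrite ℤₚ.[1+m]⊖[1+n]≡m⊖n m n = trans (ι-⊖ m n) (sym cancel-1#)
    where
    cancel-1# : (1# + ιℕ m) - (1# + ιℕ n) ≈ ιℕ m - ιℕ n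
    cancel-1# = begin
      (1# + ιℕ m) + - (1# + ιℕ n)      ≈⟨ +-cong (+-comm _ _) (sym (-‿+-comm 1# _)) ⟩
      (ιℕ m + 1#) + (- 1# + - ιℕ n)    ≈⟨ +-assoc _ _ _ ⟩
      ιℕ m + (1# + (- 1# + - ιℕ n))    ≈⟨ +-cong refl (sym (+-assoc _ _ _)) ⟩
      ιℕ m + ((1# + - 1#) + - ιℕ n)    ≈⟨ +-cong refl (trans (+-cong (-‿inverseʳ _) refl) (+-identityˡ _)) ⟩
      ιℕ m - ιℕ n                      ∎

  ι-+ : ∀ i j → ι (i ℤ.+ j) ≈ ι i + ι j
  ι-+ (+ m)    (+ n)    = ιℕ-+ m n
  ι-+ (+ m)    -[1+ n ] = ι-⊖ m (suc n)
  ι-+ -[1+ m ] (+ n)    = trans (ι-⊖ n (suc m)) (+-comm _ _)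
  ι-+ -[1+ m ] -[1+ n ] = begin
    - ιℕ (suc (suc (m ℕ.+ n)))     ≈⟨ -‿cong (reflexive (≡.cong (λ k → ιℕ (suc k)) (≡.sym (ℕₚ.+-suc m n)))) ⟩
    - ιℕ (suc m ℕ.+ suc n)         ≈⟨ -‿cong (ιℕ-+ (suc m) (suc n)) ⟩
    - (ιℕ (suc m) + ιℕ (suc n))    ≈⟨ sym (-‿+-comm _ _) ⟩
    - ιℕ (suc m) + - ιℕ (suc n)    ∎

  ι-+◃ : ∀ n → ι (Sign.+ ℤ.◃ n) ≈ ιℕ n
  ι-+◃ zero    = refl
  ι-+◃ (suc n) = refl

  ι--◃ : ∀ n → ι (Sign.- ℤ.◃ n) ≈ - ιℕ n
  ι--◃ zero    = sym -0#≈0#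
  ι--◃ (suc n) = refl

  ι-* : ∀ i j → ι (i ℤ.* j) ≈ ι i * ι j
  ι-* (+ m)    (+ n)    = trans (ι-+◃ (m ℕ.* n)) (ιℕ-* m n)
  ι-* (+ m)    -[1+ n ] = trans (ι--◃ (m ℕ.* suc n)) (trans (-‿cong (ιℕ-* m (suc n))) (-‿distribʳ-* _ _))
  ι-* -[1+ m ] (+ n)    = trans (ι--◃ (suc m ℕ.* n)) (trans (-‿cong (ιℕ-* (suc m) n)) (-‿distribˡ-* _ _))
  ι-* -[1+ m ] -[1+ n ] = begin
    ι (Sign.+ ℤ.◃ (suc m ℕ.* suc n))   ≈⟨ ι-+◃ (suc m ℕ.* suc n) ⟩
    ιℕ (suc m ℕ.* suc n)               ≈⟨ ιℕ-* (suc m) (suc n) ⟩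
    ιℕ (suc m) * ιℕ (suc n)            ≈⟨ sym (-‿involutive _) ⟩
    - - (ιℕ (suc m) * ιℕ (suc n))      ≈⟨ -‿cong (-‿distribˡ-* _ _) ⟩
    - (- ιℕ (suc m) * ιℕ (suc n))      ≈⟨ -‿distribʳ-* _ _ ⟩
    - ιℕ (suc m) * - ιℕ (suc n)        ∎

  ι-homomorphism : ℤ.+-*-rawRing -Raw-AlmostCommutative⟶ fromCommutativeRing commutativeRing
  ι-homomorphism = record
    { ⟦_⟧ = ι ; +-homo = ι-+ ; *-homo = ι-* ; -‿homo = ι-neg ; 0-homo = refl ; 1-homo = +-identityʳ 1# }

  ι-≈? : ∀ i j → Maybe (ι i ≈ ι j)
  ι-≈? i j with i ℤ.≟ j
  ... | yes ≡.refl = just refl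
  ... | no _       = nothing

  open import Algebra.Solver.Ring ℤ.+-*-rawRing (fromCommutativeRing commutativeRing) ι-homomorphism ι-≈?
  open import Algebra.Properties.Semiring.Exp semiring using (^-congˡ)

  ⟦⟧-cong : ∀ {n} (p : Polynomial n) {ρ ρ′ : Vec Carrier n} → Pointwise _≈_ ρ ρ′ → ⟦ p ⟧ ρ ≈ ⟦ p ⟧ ρ′
  ⟦⟧-cong (op [+] p q) ρ≈ρ′ = +-cong (⟦⟧-cong p ρ≈ρ′) (⟦⟧-cong q ρ≈ρ′)
  ⟦⟧-cong (op [*] p q) ρ≈ρ′ = *-cong (⟦⟧-cong p ρ≈ρ′) (⟦⟧-cong q ρ≈ρ′)
  ⟦⟧-cong (con c)      ρ≈ρ′ = refl
  ⟦⟧-cong (var x)      ρ≈ρ′ = Pointwise.lookup ρ≈ρ′ x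
  ⟦⟧-cong (p :^ n)     ρ≈ρ′ = ^-congˡ n (⟦⟧-cong p ρ≈ρ′)
  ⟦⟧-cong (:- p)       ρ≈ρ′ = -‿cong (⟦⟧-cong p ρ≈ρ′)

  ⟦_⟧ℤ : ∀ {n} → Polynomial n → Vec ℤ n → ℤ
  ⟦ op [+] p q ⟧ℤ ρ = ⟦ p ⟧ℤ ρ ℤ.+ ⟦ q ⟧ℤ ρ
  ⟦ op [*] p q ⟧ℤ ρ = ⟦ p ⟧ℤ ρ ℤ.* ⟦ q ⟧ℤ ρ
  ⟦ con c      ⟧ℤ ρ = c
  ⟦ var x      ⟧ℤ ρ = Vec.lookup ρ x
  ⟦ p :^ n     ⟧ℤ ρ = ⟦ p ⟧ℤ ρ ℤ.^ n
  ⟦ :- p       ⟧ℤ ρ = ℤ.- ⟦ p ⟧ℤ ρ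

  ι-⟦⟧ : ∀ {n} (p : Polynomial n) (ρ : Vec ℤ n) → ι (⟦ p ⟧ℤ ρ) ≈ ⟦ p ⟧ (Vec.map ι ρ)
  ι-⟦⟧ (op [+] p q) ρ = trans (ι-+ (⟦ p ⟧ℤ ρ) (⟦ q ⟧ℤ ρ)) (+-cong (ι-⟦⟧ p ρ) (ι-⟦⟧ q ρ))
  ι-⟦⟧ (op [*] p q) ρ = trans (ι-* (⟦ p ⟧ℤ ρ) (⟦ q ⟧ℤ ρ)) (*-cong (ι-⟦⟧ p ρ) (ι-⟦⟧ q ρ))
  ι-⟦⟧ (con c)      ρ = refl
  ι-⟦⟧ (var x)      ρ = reflexive (≡.sym (Vecₚ.lookup-map x ι ρ))
  ι-⟦⟧ (p :^ n)     ρ = ι-^ n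
    where
    ι-^ : ∀ n → ι (⟦ p ⟧ℤ ρ ℤ.^ n) ≈ ⟦ p :^ n ⟧ (Vec.map ι ρ)
    ι-^ zero    = +-identityʳ 1#
    ι-^ (suc n) = trans (ι-* (⟦ p ⟧ℤ ρ) (⟦ p ⟧ℤ ρ ℤ.^ n)) (*-cong (ι-⟦⟧ p ρ) (ι-^ n))
  ι-⟦⟧ (:- p)       ρ = trans (ι-neg (⟦ p ⟧ℤ ρ)) (-‿cong (ι-⟦⟧ p ρ))

  Positive : Carrier → Set ℓ₂
  Positive x = 0# < x

  NonNegative : Carrier → Set (ℓ₁ ⊔ ℓ₂)
  NonNegative x = Positive x ⊎ x ≈ 0#

  positive-resp : ∀ {x y} → x ≈ y → Positive x → Positive y
  positive-resp = <.<-respʳ-≈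

  nonNegative-resp : ∀ {x y} → x ≈ y → NonNegative x → NonNegative y
  nonNegative-resp x≈y (inj₁ x>0) = inj₁ (positive-resp x≈y x>0)
  nonNegative-resp x≈y (inj₂ x≈0) = inj₂ (trans (sym x≈y) x≈0)

  +-positive : ∀ {x y} → Positive x → NonNegative y → Positive (x + y)
  +-positive x>0 (inj₁ y>0) = <.trans y>0 (<.<-respˡ-≈ (+-identityˡ _) (+-mono-< _ x>0))
  +-positive x>0 (inj₂ y≈0) = positive-resp (trans (sym (+-identityʳ _)) (+-cong refl (sym y≈0))) x>0

  +-positiveʳ : ∀ {x y} → NonNegative x → Positive y → Positive (x + y)
  +-positiveʳ x≥0 y>0 = positive-resp (+-comm _ _) (+-positive y>0 x≥0)

  +-nonNegative : ∀ {x y} → NonNegative x → NonNegative y → NonNegative (x + y)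
  +-nonNegative (inj₁ x>0) y≥0 = inj₁ (+-positive x>0 y≥0)
  +-nonNegative (inj₂ x≈0) y≥0 = nonNegative-resp (trans (sym (+-identityˡ _)) (+-cong (sym x≈0) refl)) y≥0

  *-nonNegative : ∀ {x y} → NonNegative x → NonNegative y → NonNegative (x * y)
  *-nonNegative (inj₁ x>0) (inj₁ y>0) = inj₁ (*-pos x>0 y>0)
  *-nonNegative (inj₁ _)   (inj₂ y≈0) = inj₂ (trans (*-cong refl y≈0) (zeroʳ _))
  *-nonNegative (inj₂ x≈0) _          = inj₂ (trans (*-cong x≈0 refl) (zeroˡ _))

  <⇒positive : ∀ {x y} → x < y → Positive (y - x)
  <⇒positive {x} x<y = <.<-respˡ-≈ (-‿inverseʳ x) (+-mono-< (- x) x<y)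

  positive⇒< : ∀ {x y} → Positive (y - x) → x < y
  positive⇒< {x} {y} y-x>0 = <.<-respʳ-≈ y-x+x≈y (<.<-respˡ-≈ (+-identityˡ x) (+-mono-< x y-x>0))
    where
    y-x+x≈y : (y - x) + x ≈ y
    y-x+x≈y = trans (+-assoc _ _ _) (trans (+-cong refl (-‿inverseˡ x)) (+-identityʳ y))

  nonNegative-total : ∀ x y → NonNegative (y - x) ⊎ NonNegative (x - y)
  nonNegative-total x y with <.compare x y
  ... | tri< x<y _ _ = inj₁ (inj₁ (<⇒positive x<y))
  ... | tri≈ _ x≈y _ = inj₁ (inj₂ (trans (+-cong (sym x≈y) refl) (-‿inverseʳ x)))
  ... | tri> _ _ x>y = inj₂ (inj₁ (<⇒positive x>y))

  negative⇒positive : ∀ {x} → x < 0# → Positive (- x)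
  negative⇒positive x<0 = positive-resp (+-identityˡ _) (<⇒positive x<0)

  square-nonNegative : ∀ x → NonNegative (x * x)
  square-nonNegative x with <.compare 0# x
  ... | tri< x>0 _ _ = inj₁ (*-pos x>0 x>0)
  ... | tri≈ _ 0≈x _ = inj₂ (trans (*-cong (sym 0≈x) refl) (zeroˡ _))
  ... | tri> _ _ x<0 = inj₁ (positive-resp -x*-x≈x*x (*-pos (negative⇒positive x<0) (negative⇒positive x<0)))
    where
    -x*-x≈x*x : - x * - x ≈ x * x
    -x*-x≈x*x = trans (sym (-‿distribˡ-* _ _)) (trans (-‿cong (sym (-‿distribʳ-* _ _))) (-‿involutive _))

  *-cancel-positive : ∀ {d x} → Positive d → d * x ≈ 0# → x ≈ 0#
  *-cancel-positive {d} {x} d>0 dx≈0 with <.compare 0# x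
  ... | tri< x>0 _ _ = ⊥-elim (<.irrefl refl (positive-resp dx≈0 (*-pos d>0 x>0)))
  ... | tri≈ _ 0≈x _ = sym 0≈x
  ... | tri> _ _ x<0 = ⊥-elim (<.irrefl refl (positive-resp d*-x≈0 (*-pos d>0 (negative⇒positive x<0))))
    where
    d*-x≈0 : d * - x ≈ 0#
    d*-x≈0 = trans (sym (-‿distribʳ-* _ _)) (trans (-‿cong dx≈0) -0#≈0#)

  ιℕ-nonNegative : ∀ n → NonNegative (ιℕ n)
  ιℕ-nonNegative zero    = inj₂ refl
  ιℕ-nonNegative (suc n) = inj₁ (+-positive 0<1 (ιℕ-nonNegative n))

  ι-positive : ∀ n → Positive (ι (+ suc n))
  ι-positive n = +-positive 0<1 (ιℕ-nonNegative n)

  ι-positive⁻¹ : ∀ x → Positive (ι x) → Σ ℕ λ m → x ≡ + suc m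
  ι-positive⁻¹ (+ zero)  0>0 = ⊥-elim (<.irrefl refl 0>0)
  ι-positive⁻¹ (+ suc m) _   = m , ≡.refl
  ι-positive⁻¹ -[1+ m ]  x>0 =
    ⊥-elim (<.irrefl refl (positive-resp (-‿inverseˡ _) (+-positive x>0 (inj₁ (ι-positive m)))))

  ι-mono-≤ : ∀ {m n} → m ℕ.≤ n → NonNegative (ι (+ n) - ι (+ m))
  ι-mono-≤ {m} {n} m≤n = nonNegative-resp (begin
      ιℕ (n ℕ.∸ m)                   ≈⟨ solve 2 (λ x y → x := (y :+ x) :- y) refl _ (ιℕ m) ⟩
      (ιℕ m + ιℕ (n ℕ.∸ m)) - ιℕ m   ≈⟨ +-cong (sym (ιℕ-+ m (n ℕ.∸ m))) refl ⟩
      ιℕ (m ℕ.+ (n ℕ.∸ m)) - ιℕ m    ≡⟨ ≡.cong (λ k → ιℕ k - ιℕ m) (ℕₚ.m+[n∸m]≡n m≤n) ⟩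
      ιℕ n - ιℕ m                     ∎)
    (ιℕ-nonNegative (n ℕ.∸ m))

  ι≥-1 : ∀ {a} → -[1+ 0 ] ℤ.≤ a → NonNegative (ι a + ι (+ 1))
  ι≥-1 {+ n}          _ = +-nonNegative (ιℕ-nonNegative n) (ιℕ-nonNegative 1)
  ι≥-1 { -[1+ zero ]} _ = inj₂ (-‿inverseˡ _)
  ι≥-1 { -[1+ suc n ]} (ℤ.-≤- ())

  square-≥1 : ∀ k → k ≢ + 0 → NonNegative (ι k * ι k - ι (+ 1))
  square-≥1 k k≢0 = nonNegative-resp ι-k²-1 (k²-1≥0 k k≢0)
    where
    ι-k²-1 : ι (k ℤ.* k ℤ.- + 1) ≈ ι k * ι k - ι (+ 1)
    ι-k²-1 = trans (ι-+ (k ℤ.* k) (ℤ.- + 1)) (+-cong (ι-* k k) (ι-neg (+ 1)))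
    k²-1≥0 : ∀ k → k ≢ + 0 → NonNegative (ι (k ℤ.* k ℤ.- + 1))
    k²-1≥0 (+ zero)  0≢0 = ⊥-elim (0≢0 ≡.refl)
    k²-1≥0 (+ suc m) _   = ιℕ-nonNegative (m ℕ.+ m ℕ.* suc m)
    k²-1≥0 -[1+ m ]  _   = ιℕ-nonNegative (m ℕ.+ m ℕ.* suc m)

  monicCubic : Carrier → Carrier → Carrier → Carrier → Carrier
  monicCubic E₁ E₂ E₃ x = x * x * x - E₁ * (x * x) + E₂ * x - E₃

  elementary : Carrier → Carrier → Carrier → Vec Carrier 3
  elementary r₁ r₂ r₃ = r₁ + r₂ + r₃ ∷ r₁ * r₂ + r₁ * r₃ + r₂ * r₃ ∷ r₁ * r₂ * r₃ ∷ []

  vieta : ∀ {E₁ E₂ E₃ r₁ r₂ r₃} →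
          monicCubic E₁ E₂ E₃ r₁ ≈ 0# → monicCubic E₁ E₂ E₃ r₂ ≈ 0# → monicCubic E₁ E₂ E₃ r₃ ≈ 0# →
          r₃ < r₂ → r₂ < r₁ → Pointwise _≈_ (elementary r₁ r₂ r₃) (E₁ ∷ E₂ ∷ E₃ ∷ [])
  vieta {E₁} {E₂} {E₃} {r₁} {r₂} {r₃} f₁ f₂ f₃ r₃<r₂ r₂<r₁ =
    diff≈0⇒≈ e₁≈E₁ ∷ diff≈0⇒≈ e₂≈E₂ ∷ diff≈0⇒≈ e₃≈E₃ ∷ []
    where
    quotient : Carrier → Carrier → Carrier
    quotient p q = p * p + p * q + q * q - E₁ * (p + q) + E₂

    sub≈0 : ∀ {x y} → x ≈ 0# → y ≈ 0# → x - y ≈ 0#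
    sub≈0 x≈0 y≈0 = trans (+-cong x≈0 (trans (-‿cong y≈0) -0#≈0#)) (+-identityʳ _)

    diff≈0⇒≈ : ∀ {x y} → x - y ≈ 0# → x ≈ y
    diff≈0⇒≈ {x} {y} x-y≈0 = begin
      x              ≈⟨ solve 2 (λ x y → x := (x :- y) :+ y) refl x y ⟩
      (x - y) + y    ≈⟨ +-cong x-y≈0 refl ⟩
      0# + y         ≈⟨ +-identityˡ y ⟩
      y              ∎

    factor : ∀ p q → monicCubic E₁ E₂ E₃ p - monicCubic E₁ E₂ E₃ q ≈ (p - q) * quotient p q
    factor = solve 5 (λ E₁ E₂ E₃ p q →
        (p :* p :* p :- E₁ :* (p :* p) :+ E₂ :* p :- E₃) :- (q :* q :* q :- E₁ :* (q :* q) :+ E₂ :* q :- E₃)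
      := (p :- q) :* (p :* p :+ p :* q :+ q :* q :- E₁ :* (p :+ q) :+ E₂)) refl E₁ E₂ E₃

    quotient-root : ∀ {p q} → q < p → monicCubic E₁ E₂ E₃ p ≈ 0# → monicCubic E₁ E₂ E₃ q ≈ 0# → quotient p q ≈ 0#
    quotient-root {p} {q} q<p fp fq = *-cancel-positive (<⇒positive q<p) (trans (sym (factor p q)) (sub≈0 fp fq))

    q₁₂ : quotient r₁ r₂ ≈ 0#
    q₁₂ = quotient-root r₂<r₁ f₁ f₂

    q₁₃ : quotient r₁ r₃ ≈ 0#
    q₁₃ = quotient-root (<.trans r₃<r₂ r₂<r₁) f₁ f₃

    e₁≈E₁ : r₁ + r₂ + r₃ - E₁ ≈ 0#
    e₁≈E₁ = *-cancel-positive (<⇒positive r₃<r₂) (begin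
      (r₂ - r₃) * (r₁ + r₂ + r₃ - E₁)          ≈⟨ solve 5 (λ E₁ E₂ r₁ r₂ r₃ →
        (r₂ :- r₃) :* (r₁ :+ r₂ :+ r₃ :- E₁)
          := (r₁ :* r₁ :+ r₁ :* r₂ :+ r₂ :* r₂ :- E₁ :* (r₁ :+ r₂) :+ E₂)
             :- (r₁ :* r₁ :+ r₁ :* r₃ :+ r₃ :* r₃ :- E₁ :* (r₁ :+ r₃) :+ E₂)) refl E₁ E₂ r₁ r₂ r₃ ⟩
      quotient r₁ r₂ - quotient r₁ r₃          ≈⟨ sub≈0 q₁₂ q₁₃ ⟩
      0#                                       ∎)

    e₂≈E₂ : r₁ * r₂ + r₁ * r₃ + r₂ * r₃ - E₂ ≈ 0#
    e₂≈E₂ = begin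
      r₁ * r₂ + r₁ * r₃ + r₂ * r₃ - E₂               ≈⟨ solve 5 (λ E₁ E₂ r₁ r₂ r₃ →
        r₁ :* r₂ :+ r₁ :* r₃ :+ r₂ :* r₃ :- E₂
          := (r₁ :+ r₂) :* (r₁ :+ r₂ :+ r₃ :- E₁)
             :- (r₁ :* r₁ :+ r₁ :* r₂ :+ r₂ :* r₂ :- E₁ :* (r₁ :+ r₂) :+ E₂)) refl E₁ E₂ r₁ r₂ r₃ ⟩
      (r₁ + r₂) * (r₁ + r₂ + r₃ - E₁) - quotient r₁ r₂ ≈⟨ sub≈0 (trans (*-cong refl e₁≈E₁) (zeroʳ _)) q₁₂ ⟩
      0#                                             ∎

    e₃≈E₃ : r₁ * r₂ * r₃ - E₃ ≈ 0#
    e₃≈E₃ = begin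
      r₁ * r₂ * r₃ - E₃      ≈⟨ solve 6 (λ E₁ E₂ E₃ r₁ r₂ r₃ →
        r₁ :* r₂ :* r₃ :- E₃
          := (r₁ :* r₁ :* r₁ :- E₁ :* (r₁ :* r₁) :+ E₂ :* r₁ :- E₃)
             :- r₁ :* r₁ :* (r₁ :+ r₂ :+ r₃ :- E₁)
             :+ r₁ :* (r₁ :* r₂ :+ r₁ :* r₃ :+ r₂ :* r₃ :- E₂)) refl E₁ E₂ E₃ r₁ r₂ r₃ ⟩
      monicCubic E₁ E₂ E₃ r₁ - r₁ * r₁ * (r₁ + r₂ + r₃ - E₁) + r₁ * (r₁ * r₂ + r₁ * r₃ + r₂ * r₃ - E₂)
                             ≈⟨ +-cong (sub≈0 f₁ (trans (*-cong refl e₁≈E₁) (zeroʳ _))) (*-cong refl e₂≈E₂) ⟩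
      0# + r₁ * 0#           ≈⟨ trans (+-identityˡ _) (zeroʳ _) ⟩
      0#                     ∎

  vandermonde : Carrier → Carrier → Carrier → Carrier
  vandermonde p q r = (p - q) * (p - r) * (q - r)

  vandermonde²-swap₁₂ : ∀ p q r → vandermonde q p r * vandermonde q p r ≈ vandermonde p q r * vandermonde p q r
  vandermonde²-swap₁₂ = solve 3 (λ p q r →
      ((q :- p) :* (q :- r) :* (p :- r)) :* ((q :- p) :* (q :- r) :* (p :- r))
    := ((p :- q) :* (p :- r) :* (q :- r)) :* ((p :- q) :* (p :- r) :* (q :- r))) refl

  vandermonde²-swap₂₃ : ∀ p q r → vandermonde p r q * vandermonde p r q ≈ vandermonde p q r * vandermonde p q r
  vandermonde²-swap₂₃ = solve 3 (λ p q r →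
      ((p :- r) :* (p :- q) :* (r :- q)) :* ((p :- r) :* (p :- q) :* (r :- q))
    := ((p :- q) :* (p :- r) :* (q :- r)) :* ((p :- q) :* (p :- r) :* (q :- r))) refl

  vandermonde²-certificate : ∀ p q r → let d₁ = q - p; d₂ = r - q; S = d₁ + d₂ in
    ι (+ 729) - ι (+ 16) * (vandermonde p q r * vandermonde p q r)
      ≈ ((ι (+ 3) - r) + p) * (ι (+ 9) + ι (+ 3) * S + S * S) * (ι (+ 27) + S * S * S)
        + S * S * ((d₁ - d₂) * (d₁ - d₂)) * (S * S + ι (+ 4) * d₁ * d₂)
  vandermonde²-certificate = solve 3 (λ p q r → let d₁ = q :- p; d₂ = r :- q; S = d₁ :+ d₂ in
      con (+ 729) :- con (+ 16) :* (((p :- q) :* (p :- r) :* (q :- r)) :* ((p :- q) :* (p :- r) :* (q :- r)))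
    := ((con (+ 3) :- r) :+ p) :* (con (+ 9) :+ con (+ 3) :* S :+ S :* S) :* (con (+ 27) :+ S :* S :* S)
       :+ S :* S :* ((d₁ :- d₂) :* (d₁ :- d₂)) :* (S :* S :+ con (+ 4) :* d₁ :* d₂)) refl

  vandermonde²-bound-sorted : ∀ {p q r} → Positive p → NonNegative (q - p) → NonNegative (r - q) →
    NonNegative (ι (+ 3) - r) → (ι (+ 16) * (vandermonde p q r * vandermonde p q r)) < ι (+ 729)
  vandermonde²-bound-sorted {p} {q} {r} p>0 d₁≥0 d₂≥0 r≤3 =
    positive⇒< (positive-resp (sym (vandermonde²-certificate p q r)) (+-positive main-term remainder))
    where
    d₁ d₂ S : Carrier
    d₁ = q - p
    d₂ = r - q
    S = d₁ + d₂
    S≥0 : NonNegative S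
    S≥0 = +-nonNegative d₁≥0 d₂≥0
    main-term : Positive (((ι (+ 3) - r) + p) * (ι (+ 9) + ι (+ 3) * S + S * S) * (ι (+ 27) + S * S * S))
    main-term =
      *-pos (*-pos (+-positiveʳ r≤3 p>0)
                   (+-positive (+-positive (ι-positive 8) (*-nonNegative (ιℕ-nonNegative 3) S≥0))
                               (square-nonNegative S)))
            (+-positive (ι-positive 26) (*-nonNegative (square-nonNegative S) S≥0))
    remainder : NonNegative (S * S * ((d₁ - d₂) * (d₁ - d₂)) * (S * S + ι (+ 4) * d₁ * d₂))
    remainder =
      *-nonNegative (*-nonNegative (square-nonNegative S) (square-nonNegative (d₁ - d₂)))
                    (+-nonNegative (square-nonNegative S)
                                   (*-nonNegative (*-nonNegative (ιℕ-nonNegative 4) d₁≥0) d₂≥0))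

  vandermonde²-bound-resp : ∀ {p q r t₁ t₂ t₃} →
    vandermonde p q r * vandermonde p q r ≈ vandermonde t₁ t₂ t₃ * vandermonde t₁ t₂ t₃ →
    (ι (+ 16) * (vandermonde p q r * vandermonde p q r)) < ι (+ 729) →
    (ι (+ 16) * (vandermonde t₁ t₂ t₃ * vandermonde t₁ t₂ t₃)) < ι (+ 729)
  vandermonde²-bound-resp V²≈ = <.<-respˡ-≈ (*-cong refl V²≈)

  vandermonde²-bound : ∀ {t₁ t₂ t₃} → Positive t₁ → Positive t₂ → Positive t₃ →
    NonNegative (ι (+ 3) - t₁) → NonNegative (ι (+ 3) - t₂) → NonNegative (ι (+ 3) - t₃) →
    (ι (+ 16) * (vandermonde t₁ t₂ t₃ * vandermonde t₁ t₂ t₃)) < ι (+ 729)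
  vandermonde²-bound {t₁} {t₂} {t₃} t₁>0 t₂>0 t₃>0 t₁≤3 t₂≤3 t₃≤3
    with nonNegative-total t₁ t₂ | nonNegative-total t₁ t₃ | nonNegative-total t₂ t₃
  ... | inj₁ t₁≤t₂ | _          | inj₁ t₂≤t₃ = vandermonde²-bound-sorted t₁>0 t₁≤t₂ t₂≤t₃ t₃≤3
  ... | inj₁ t₁≤t₂ | inj₁ t₁≤t₃ | inj₂ t₃≤t₂ =
    vandermonde²-bound-resp (vandermonde²-swap₂₃ t₁ t₂ t₃) (vandermonde²-bound-sorted t₁>0 t₁≤t₃ t₃≤t₂ t₂≤3)
  ... | inj₁ t₁≤t₂ | inj₂ t₃≤t₁ | inj₂ t₃≤t₂ =
    vandermonde²-bound-resp (trans (vandermonde²-swap₁₂ t₁ t₃ t₂) (vandermonde²-swap₂₃ t₁ t₂ t₃))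
                            (vandermonde²-bound-sorted t₃>0 t₃≤t₁ t₁≤t₂ t₂≤3)
  ... | inj₂ t₂≤t₁ | inj₁ t₁≤t₃ | _          =
    vandermonde²-bound-resp (vandermonde²-swap₁₂ t₁ t₂ t₃) (vandermonde²-bound-sorted t₂>0 t₂≤t₁ t₁≤t₃ t₃≤3)
  ... | inj₂ t₂≤t₁ | inj₂ t₃≤t₁ | inj₁ t₂≤t₃ =
    vandermonde²-bound-resp (trans (vandermonde²-swap₂₃ t₂ t₁ t₃) (vandermonde²-swap₁₂ t₁ t₂ t₃))
                            (vandermonde²-bound-sorted t₂>0 t₂≤t₃ t₃≤t₁ t₁≤3)
  ... | inj₂ t₂≤t₁ | _          | inj₂ t₃≤t₂ =
    vandermonde²-bound-resp (trans (vandermonde²-swap₁₂ t₂ t₃ t₁)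
                                   (trans (vandermonde²-swap₂₃ t₂ t₁ t₃) (vandermonde²-swap₁₂ t₁ t₂ t₃)))
                            (vandermonde²-bound-sorted t₃>0 t₃≤t₂ t₂≤t₁ t₁≤3)

  cubicFormᵖ : ∀ {n} → Polynomial n → Polynomial n → Polynomial n → Polynomial n
  cubicFormᵖ a u v = u :* u :* u :- a :* (u :* u) :* v :- (a :+ con (+ 3)) :* u :* (v :* v) :- v :* v :* v

  cubicFormᴿ : Carrier → Carrier → Carrier → Carrier
  cubicFormᴿ A u v = ⟦ cubicFormᵖ (var (# 0)) (var (# 1)) (var (# 2)) ⟧ (A ∷ u ∷ v ∷ [])

  ι-cubicForm : ∀ a u v → ι (cubicForm a u v) ≈ cubicFormᴿ (ι a) (ι u) (ι v)
  ι-cubicForm a u v = ι-⟦⟧ (cubicFormᵖ (var (# 0)) (var (# 1)) (var (# 2))) (a ∷ u ∷ v ∷ [])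

  -- Y + Z (rᵢ + rⱼ) = (Y + Z E₁) − Z r_k, so the product over the three pairs is
  -- ∏ₖ (u − v r_k) = u³ − E₁ u² v + E₂ u v² − E₃ v³ at u = Y + Z E₁, v = Z.
  pairSumsᵖ : ∀ {n} → Polynomial n → Polynomial n → Polynomial n → Polynomial n → Polynomial n → Polynomial n
  pairSumsᵖ E₁ E₂ E₃ Y Z = let u = Y :+ Z :* E₁ in
    u :* u :* u :- E₁ :* (u :* u) :* Z :+ E₂ :* u :* (Z :* Z) :- E₃ :* (Z :* Z :* Z)

  pairSumsᴿ : Carrier → Carrier → Carrier → Carrier → Carrier → Carrier
  pairSumsᴿ E₁ E₂ E₃ Y Z =
    ⟦ pairSumsᵖ (var (# 0)) (var (# 1)) (var (# 2)) (var (# 3)) (var (# 4)) ⟧ (E₁ ∷ E₂ ∷ E₃ ∷ Y ∷ Z ∷ [])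

  pairSums-elementary : ∀ r₁ r₂ r₃ Y Z →
    (Y + Z * (r₁ + r₂)) * (Y + Z * (r₁ + r₃)) * (Y + Z * (r₂ + r₃))
      ≈ pairSumsᴿ (r₁ + r₂ + r₃) (r₁ * r₂ + r₁ * r₃ + r₂ * r₃) (r₁ * r₂ * r₃) Y Z
  pairSums-elementary = solve 5 (λ r₁ r₂ r₃ Y Z →
      (Y :+ Z :* (r₁ :+ r₂)) :* (Y :+ Z :* (r₁ :+ r₃)) :* (Y :+ Z :* (r₂ :+ r₃))
    := pairSumsᵖ (r₁ :+ r₂ :+ r₃) (r₁ :* r₂ :+ r₁ :* r₃ :+ r₂ :* r₃) (r₁ :* r₂ :* r₃) Y Z) refl

  discriminantᵖ : ∀ {n} → Polynomial n → Polynomial n → Polynomial n → Polynomial n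
  discriminantᵖ E₁ E₂ E₃ = E₁ :* E₁ :* E₂ :* E₂ :- con (+ 4) :* E₂ :* E₂ :* E₂ :- con (+ 4) :* E₁ :* E₁ :* E₁ :* E₃
     :+ con (+ 18) :* E₁ :* E₂ :* E₃ :- con (+ 27) :* E₃ :* E₃

  discriminantᴿ : Carrier → Carrier → Carrier → Carrier
  discriminantᴿ E₁ E₂ E₃ = ⟦ discriminantᵖ (var (# 0)) (var (# 1)) (var (# 2)) ⟧ (E₁ ∷ E₂ ∷ E₃ ∷ [])

  vandermonde²-elementary : ∀ r₁ r₂ r₃ →
    vandermonde r₁ r₂ r₃ * vandermonde r₁ r₂ r₃ ≈ discriminantᴿ (r₁ + r₂ + r₃) (r₁ * r₂ + r₁ * r₃ + r₂ * r₃) (r₁ * r₂ * r₃)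
  vandermonde²-elementary = solve 3 (λ r₁ r₂ r₃ →
      ((r₁ :- r₂) :* (r₁ :- r₃) :* (r₂ :- r₃)) :* ((r₁ :- r₂) :* (r₁ :- r₃) :* (r₂ :- r₃))
    := discriminantᵖ (r₁ :+ r₂ :+ r₃) (r₁ :* r₂ :+ r₁ :* r₃ :+ r₂ :* r₃) (r₁ :* r₂ :* r₃)) refl

  eval-sub : ∀ x y z p q → eval R (x , y , z) p - eval R (x , y , z) q ≈ (p - q) * (ι y + ι z * (p + q))
  eval-sub x y z p q = solve 5 (λ X Y Z p q →
      (X :+ Y :* p :+ Z :* (p :* p)) :- (X :+ Y :* q :+ Z :* (q :* q))
    := (p :- q) :* (Y :+ Z :* (p :+ q))) refl (ι x) (ι y) (ι z) p q

  vandermonde-eval : ∀ x y z r₁ r₂ r₃ → let Y = ι y; Z = ι z in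
    vandermonde (eval R (x , y , z) r₁) (eval R (x , y , z) r₂) (eval R (x , y , z) r₃)
      ≈ vandermonde r₁ r₂ r₃ * ((Y + Z * (r₁ + r₂)) * (Y + Z * (r₁ + r₃)) * (Y + Z * (r₂ + r₃)))
  vandermonde-eval x y z r₁ r₂ r₃ =
    trans (*-cong (*-cong (eval-sub x y z r₁ r₂) (eval-sub x y z r₁ r₃)) (eval-sub x y z r₂ r₃))
          (solve 6 (λ d₁ d₂ d₃ w₁ w₂ w₃ → (d₁ :* w₁) :* (d₂ :* w₂) :* (d₃ :* w₃) := (d₁ :* d₂ :* d₃) :* (w₁ :* w₂ :* w₃))
                 refl _ _ _ _ _ _)

  discriminantRoot : Carrier → Carrier
  discriminantRoot A = A * A + ι (+ 3) * A + ι (+ 9)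

  -- With N = (A + 1)(A + 2): A² + 3A + 9 = N + 7, so its square is N(N + 14) + 49, and 16·49 = 729 + 55.
  index-bound : ∀ {A F} → NonNegative (A + ι (+ 1)) → NonNegative (F * F - ι (+ 1)) →
    ι (+ 729) < (ι (+ 16) * ((discriminantRoot A * discriminantRoot A) * (F * F)))
  index-bound {A} {F} A≥-1 F²≥1 = positive⇒< (positive-resp (sym certificate) (+-positiveʳ sum≥0 (ι-positive 54)))
    where
    N : Carrier
    N = (A + ι (+ 1)) * (A + ι (+ 2))
    certificate : ι (+ 16) * ((discriminantRoot A * discriminantRoot A) * (F * F)) - ι (+ 729)
      ≈ ι (+ 16) * (N * (N + ι (+ 14)) * (F * F) + ι (+ 49) * (F * F - ι (+ 1))) + ι (+ 55)
    certificate = solve 2 (λ A F → let N = (A :+ con (+ 1)) :* (A :+ con (+ 2)) in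
        con (+ 16) :* (((A :* A :+ con (+ 3) :* A :+ con (+ 9)) :* (A :* A :+ con (+ 3) :* A :+ con (+ 9))) :* (F :* F))
          :- con (+ 729)
      := con (+ 16) :* (N :* (N :+ con (+ 14)) :* (F :* F) :+ con (+ 49) :* (F :* F :- con (+ 1))) :+ con (+ 55)) refl A F
    N≥0 : NonNegative N
    N≥0 = *-nonNegative A≥-1 (nonNegative-resp (solve 1 (λ A → A :+ con (+ 1) :+ con (+ 1) := A :+ con (+ 2)) refl A)
                                                (+-nonNegative A≥-1 (ιℕ-nonNegative 1)))
    sum≥0 : NonNegative (ι (+ 16) * (N * (N + ι (+ 14)) * (F * F) + ι (+ 49) * (F * F - ι (+ 1))))
    sum≥0 = *-nonNegative (ιℕ-nonNegative 16)
              (+-nonNegative (*-nonNegative (*-nonNegative N≥0 (+-nonNegative N≥0 (ιℕ-nonNegative 14))) (square-nonNegative F))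
                             (*-nonNegative (ιℕ-nonNegative 49) F²≥1))

  eval-⊕ : ∀ α β r → eval R α r + eval R β r ≈ eval R (α ⊕ β) r
  eval-⊕ (x , y , z) (x′ , y′ , z′) r = trans (regroup (ι x) (ι y) (ι z) (ι x′) (ι y′) (ι z′) r)
      (sym (+-cong (+-cong (ι-+ x x′) (*-cong (ι-+ y y′) refl)) (*-cong (ι-+ z z′) refl)))
    where
    regroup : ∀ a b c a′ b′ c′ r → (a + b * r + c * (r * r)) + (a′ + b′ * r + c′ * (r * r))
                                   ≈ (a + a′) + (b + b′) * r + (c + c′) * (r * r)
    regroup = solve 7 (λ a b c a′ b′ c′ r → (a :+ b :* r :+ c :* (r :* r)) :+ (a′ :+ b′ :* r :+ c′ :* (r :* r))
                                         := (a :+ a′) :+ (b :+ b′) :* r :+ (c :+ c′) :* (r :* r)) refl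

  eval-int : ∀ k r → eval R (int k) r ≈ ι k
  eval-int k r = solve 2 (λ X r → X :+ con (+ 0) :* r :+ con (+ 0) :* (r :* r) := X) refl (ι k) r

  totallyPositive₀⇒nonNegative : ∀ {r₁ r₂ r₃ α} → TotPos₀ R r₁ r₂ r₃ α →
    NonNegative (eval R α r₁) × NonNegative (eval R α r₂) × NonNegative (eval R α r₃)
  totallyPositive₀⇒nonNegative {r₁} {r₂} {r₃} (inj₁ ≡.refl) =
    inj₂ (eval-int (+ 0) r₁) , inj₂ (eval-int (+ 0) r₂) , inj₂ (eval-int (+ 0) r₃)
  totallyPositive₀⇒nonNegative (inj₂ (t₁>0 , t₂>0 , t₃>0)) = inj₁ t₁>0 , inj₁ t₂>0 , inj₁ t₃>0

  summand-bounded : ∀ {n k} α β r → n ℕ.≤ k → α ⊕ β ≡ int (+ n) → NonNegative (eval R β r) →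
    NonNegative (ι (+ k) - eval R α r)
  summand-bounded {n} {k} α β r n≤k α⊕β≡n β≥0 = nonNegative-resp (begin
      (ι (+ k) - (s + t)) + t    ≈⟨ solve 3 (λ c s t → (c :- (s :+ t)) :+ t := c :- s) refl (ι (+ k)) s t ⟩
      ι (+ k) - s                ∎)
    (+-nonNegative (nonNegative-resp (+-cong refl (-‿cong (sym s+t≈n))) (ι-mono-≤ n≤k)) β≥0)
    where
    s t : Carrier
    s = eval R α r
    t = eval R β r
    s+t≈n : s + t ≈ ι (+ n)
    s+t≈n = trans (eval-⊕ α β r) (trans (reflexive (≡.cong (λ γ → eval R γ r) α⊕β≡n)) (eval-int (+ n) r))

  module _ {a : ℤ} (a≥-1 : -[1+ 0 ] ℤ.≤ a) {r₁ r₂ r₃ : Carrier}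
           (root₁ : cubic R a r₁ ≈ 0#) (root₂ : cubic R a r₂ ≈ 0#) (root₃ : cubic R a r₃ ≈ 0#)
           (r₃<r₂ : r₃ < r₂) (r₂<r₁ : r₂ < r₁) where

    coefficients : Vec Carrier 3
    coefficients = ι a ∷ - (ι a + ι (+ 3)) ∷ ι (+ 1) ∷ []

    elementary≈coefficients : Pointwise _≈_ (elementary r₁ r₂ r₃) coefficients
    elementary≈coefficients =
      Pointwise.trans trans (vieta (monic root₁) (monic root₂) (monic root₃) r₃<r₂ r₂<r₁)
                            (refl ∷ -‿cong (ι-+ a (+ 3)) ∷ sym (+-identityʳ 1#) ∷ [])
      where
      monic : ∀ {x} → cubic R a x ≈ 0# → monicCubic (ι a) (- ι (a ℤ.+ + 3)) 1# x ≈ 0#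
      monic = trans (+-cong (+-cong refl (sym (-‿distribˡ-* _ _))) refl)

    vandermonde²-roots : vandermonde r₁ r₂ r₃ * vandermonde r₁ r₂ r₃ ≈ discriminantRoot (ι a) * discriminantRoot (ι a)
    vandermonde²-roots = begin
      vandermonde r₁ r₂ r₃ * vandermonde r₁ r₂ r₃
        ≈⟨ vandermonde²-elementary r₁ r₂ r₃ ⟩
      discriminantᴿ (r₁ + r₂ + r₃) (r₁ * r₂ + r₁ * r₃ + r₂ * r₃) (r₁ * r₂ * r₃)
        ≈⟨ ⟦⟧-cong (discriminantᵖ (var (# 0)) (var (# 1)) (var (# 2))) elementary≈coefficients ⟩
      discriminantᴿ (ι a) (- (ι a + ι (+ 3))) (ι (+ 1))
        ≈⟨ solve 1 (λ A → let D = A :* A :+ con (+ 3) :* A :+ con (+ 9) in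
                            discriminantᵖ A (:- (A :+ con (+ 3))) (con (+ 1)) := D :* D) refl (ι a) ⟩
      discriminantRoot (ι a) * discriminantRoot (ι a) ∎

    pairSums-roots : ∀ y z → let Y = ι y; Z = ι z in
      (Y + Z * (r₁ + r₂)) * (Y + Z * (r₁ + r₃)) * (Y + Z * (r₂ + r₃)) ≈ ι (cubicForm a (y ℤ.+ z ℤ.* a) z)
    pairSums-roots y z = begin
      (ι y + ι z * (r₁ + r₂)) * (ι y + ι z * (r₁ + r₃)) * (ι y + ι z * (r₂ + r₃))
        ≈⟨ pairSums-elementary r₁ r₂ r₃ (ι y) (ι z) ⟩
      pairSumsᴿ (r₁ + r₂ + r₃) (r₁ * r₂ + r₁ * r₃ + r₂ * r₃) (r₁ * r₂ * r₃) (ι y) (ι z)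
        ≈⟨ ⟦⟧-cong (pairSumsᵖ (var (# 0)) (var (# 1)) (var (# 2)) (var (# 3)) (var (# 4)))
                   (Pointwise.++⁺ elementary≈coefficients (refl ∷ refl ∷ [])) ⟩
      pairSumsᴿ (ι a) (- (ι a + ι (+ 3))) (ι (+ 1)) (ι y) (ι z)
        ≈⟨ solve 3 (λ A Y Z → pairSumsᵖ A (:- (A :+ con (+ 3))) (con (+ 1)) Y Z := cubicFormᵖ A (Y :+ Z :* A) Z)
                   refl (ι a) (ι y) (ι z) ⟩
      cubicFormᴿ (ι a) (ι y + ι z * ι a) (ι z)
        ≈⟨ ⟦⟧-cong (cubicFormᵖ (var (# 0)) (var (# 1)) (var (# 2)))
                   (refl ∷ sym (trans (ι-+ y (z ℤ.* a)) (+-cong refl (ι-* z a))) ∷ refl ∷ []) ⟩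
      cubicFormᴿ (ι a) (ι (y ℤ.+ z ℤ.* a)) (ι z)
        ≈⟨ sym (ι-cubicForm a (y ℤ.+ z ℤ.* a) z) ⟩
      ι (cubicForm a (y ℤ.+ z ℤ.* a) z) ∎

    totallyPositive≤3⇒rational : ∀ x y z → TotPos R r₁ r₂ r₃ (x , y , z) →
      NonNegative (ι (+ 3) - eval R (x , y , z) r₁) → NonNegative (ι (+ 3) - eval R (x , y , z) r₂) →
      NonNegative (ι (+ 3) - eval R (x , y , z) r₃) → y ≡ + 0 × z ≡ + 0
    totallyPositive≤3⇒rational x y z (t₁>0 , t₂>0 , t₃>0) t₁≤3 t₂≤3 t₃≤3
      with cubicForm a (y ℤ.+ z ℤ.* a) z ℤ.≟ + 0
    ... | yes F≡0 = rational (cubicForm≡0⇒trivial a (y ℤ.+ z ℤ.* a) z F≡0)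
      where
      rational : y ℤ.+ z ℤ.* a ≡ + 0 × z ≡ + 0 → y ≡ + 0 × z ≡ + 0
      rational (u≡0 , ≡.refl) = ≡.trans (≡.sym (ℤₚ.+-identityʳ y)) u≡0 , ≡.refl
    ... | no F≢0 = ⊥-elim (<.asym (vandermonde²-bound t₁>0 t₂>0 t₃>0 t₁≤3 t₂≤3 t₃≤3) large)
      where
      t₁ t₂ t₃ V D F : Carrier
      t₁ = eval R (x , y , z) r₁
      t₂ = eval R (x , y , z) r₂
      t₃ = eval R (x , y , z) r₃
      V = vandermonde t₁ t₂ t₃
      D = discriminantRoot (ι a)
      F = ι (cubicForm a (y ℤ.+ z ℤ.* a) z)
      V²≈D²F² : V * V ≈ (D * D) * (F * F)
      V²≈D²F² = begin
        V * V                       ≈⟨ *-cong V≈ V≈ ⟩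
        (V₀ * F) * (V₀ * F)         ≈⟨ solve 2 (λ d f → (d :* f) :* (d :* f) := (d :* d) :* (f :* f)) refl V₀ F ⟩
        (V₀ * V₀) * (F * F)         ≈⟨ *-cong vandermonde²-roots refl ⟩
        (D * D) * (F * F)           ∎
        where
        V₀ : Carrier
        V₀ = vandermonde r₁ r₂ r₃
        V≈ : V ≈ V₀ * F
        V≈ = trans (vandermonde-eval x y z r₁ r₂ r₃) (*-cong refl (pairSums-roots y z))
      large : ι (+ 729) < (ι (+ 16) * (V * V))
      large = <.<-respʳ-≈ (*-cong refl (sym V²≈D²F²)) (index-bound (ι≥-1 a≥-1) (square-≥1 _ F≢0))

    summand-positiveInteger : ∀ {n α β} → n ℕ.≤ 3 → TotPos R r₁ r₂ r₃ α → TotPos₀ R r₁ r₂ r₃ β →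
      α ⊕ β ≡ int (+ n) → Σ ℕ λ m → α ≡ int (+ suc m)
    summand-positiveInteger {n} {x , y , z} {β} n≤3 α>0@(t₁>0 , _ , _) β≥0 α⊕β≡n =
      integer (totallyPositive≤3⇒rational x y z α>0 (≤3 r₁ β₁≥0) (≤3 r₂ β₂≥0) (≤3 r₃ β₃≥0))
      where
      β₁≥0 : NonNegative (eval R β r₁)
      β₂≥0 : NonNegative (eval R β r₂)
      β₃≥0 : NonNegative (eval R β r₃)
      β₁≥0 = proj₁ (totallyPositive₀⇒nonNegative β≥0)
      β₂≥0 = proj₁ (proj₂ (totallyPositive₀⇒nonNegative β≥0))
      β₃≥0 = proj₂ (proj₂ (totallyPositive₀⇒nonNegative β≥0))
      ≤3 : ∀ r → NonNegative (eval R β r) → NonNegative (ι (+ 3) - eval R (x , y , z) r)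
      ≤3 r = summand-bounded (x , y , z) β r n≤3 α⊕β≡n
      integer : y ≡ + 0 × z ≡ + 0 → Σ ℕ λ m → (x , y , z) ≡ int (+ suc m)
      integer (≡.refl , ≡.refl) = Prod.map₂ (≡.cong int) (ι-positive⁻¹ x (positive-resp (eval-int x r₁) t₁>0))

    summand-integer : ∀ {n α β} → n ℕ.≤ 3 → TotPos₀ R r₁ r₂ r₃ α → TotPos₀ R r₁ r₂ r₃ β →
      α ⊕ β ≡ int (+ n) → Σ ℕ λ m → α ≡ int (+ m)
    summand-integer _   (inj₁ α≡0) _   _     = 0 , α≡0
    summand-integer n≤3 (inj₂ α>0) β≥0 α⊕β≡n = Prod.map suc id (summand-positiveInteger n≤3 α>0 β≥0 α⊕β≡n)

    sum-integerParts : ∀ {n} α₁ α₂ → n ℕ.≤ 3 → TotPos₀ R r₁ r₂ r₃ α₁ → TotPos₀ R r₁ r₂ r₃ α₂ →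
      α₁ ⊕ α₂ ≡ int (+ n) → IntegerParts α₁ α₂ n
    sum-integerParts α₁ α₂ n≤3 α₁≥0 α₂≥0 α₁⊕α₂≡n
      with summand-integer n≤3 α₁≥0 α₂≥0 α₁⊕α₂≡n | summand-integer n≤3 α₂≥0 α₁≥0 (≡.trans (⊕-comm α₂ α₁) α₁⊕α₂≡n)
    ... | m₁ , ≡.refl | m₂ , ≡.refl = m₁ , m₂ , ≡.refl , ≡.refl , ℤₚ.+-injective (≡.cong proj₁ α₁⊕α₂≡n)

lemma5p2 : ∀ {c ℓ₁ ℓ₂} (R : OrderedCommRing c ℓ₁ ℓ₂) (a : ℤ) → -[1+ 0 ] ≤ a →
    (ρ₁ ρ₂ ρ₃ : OrderedCommRing.Carrier R) →
    OrderedCommRing._≈_ R (cubic R a ρ₁) (OrderedCommRing.0# R) →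
    OrderedCommRing._≈_ R (cubic R a ρ₂) (OrderedCommRing.0# R) →
    OrderedCommRing._≈_ R (cubic R a ρ₃) (OrderedCommRing.0# R) →
    OrderedCommRing._<_ R ρ₃ ρ₂ → OrderedCommRing._<_ R ρ₂ ρ₁ →
    ((α₁ α₂ : Zρ) → TotPos₀ R ρ₁ ρ₂ ρ₃ α₁ → TotPos₀ R ρ₁ ρ₂ ρ₃ α₂ →
      α₁ ⊕ α₂ ≡ int (+ 2) →
      ((α₁ ≡ int (+ 0) × α₂ ≡ int (+ 2)) ⊎ (α₁ ≡ int (+ 2) × α₂ ≡ int (+ 0)))
      ⊎ (α₁ ≡ int (+ 1) × α₂ ≡ int (+ 1)))
    ×
    ((α₁ α₂ : Zρ) → TotPos₀ R ρ₁ ρ₂ ρ₃ α₁ → TotPos₀ R ρ₁ ρ₂ ρ₃ α₂ →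
      α₁ ⊕ α₂ ≡ int (+ 3) →
      ((α₁ ≡ int (+ 0) × α₂ ≡ int (+ 3)) ⊎ (α₁ ≡ int (+ 3) × α₂ ≡ int (+ 0)))
      ⊎ ((α₁ ≡ int (+ 1) × α₂ ≡ int (+ 2)) ⊎ (α₁ ≡ int (+ 2) × α₂ ≡ int (+ 1))))
lemma5p2 R a a≥-1 ρ₁ ρ₂ ρ₃ root₁ root₂ root₃ ρ₃<ρ₂ ρ₂<ρ₁ =
    (λ α₁ α₂ α₁≥0 α₂≥0 → integerParts₂ ∘ parts α₁ α₂ (ℕₚ.n≤1+n 2) α₁≥0 α₂≥0)
  , (λ α₁ α₂ α₁≥0 α₂≥0 → integerParts₃ ∘ parts α₁ α₂ ℕₚ.≤-refl α₁≥0 α₂≥0)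
  where
  parts : ∀ {n} α₁ α₂ → n ℕ.≤ 3 → TotPos₀ R ρ₁ ρ₂ ρ₃ α₁ → TotPos₀ R ρ₁ ρ₂ ρ₃ α₂ →
          α₁ ⊕ α₂ ≡ int (+ n) → IntegerParts α₁ α₂ n
  parts = sum-integerParts R a≥-1 root₁ root₂ root₃ ρ₃<ρ₂ ρ₂<ρ₁
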